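{- For any positive integers $Q,M,t$ (with $1\le t\le M$) and any $0<\varepsilon<1$, $$\Pr_{\vec a\sim\mathbb{Z}_Q^M,\ c\sim\mathbb{Z}_Q}\Big[p_{\vec a,c,t}\ \ge\ \frac{1+\varepsilon}{1-\varepsilon}\cdot\frac{t}{M}\Big]\ \le\ \frac{4Q^{1/4}}{\varepsilon\cdot\binom{M-1}{t-1}^{1/4}},$$ where $\vec a$ and $c$ are uniform and independent, and $p_{\vec a,c,t}$ is the probability that a uniformly random $t$-element subset $S\subseteq[M]$ subject to $\sum_{i\in S}a_i\equiv c\pmod Q$ contains the index $1$ (with $p_{\vec a,c,t}:=1$ if no such subset exists).
   Context: In the paper's notation, $p_{\vec a,c,t}:=p_{\vec a,c,\{1\},\{1\},t}$ is the $t$-hitting probability with $I=J=\{1\}$, which for a single target $c$ reduces to the quantity described in the claim. $\binom{[M]}{t}$ denotes the set of $t$-element subsets of $[M]=\{1,\ldots,M\}$.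
   Formalization: The parameter ε ranges over the rationals strictly between 0 and 1. -}

module Defs where

open import Data.Nat as ℕ using (ℕ; zero; suc; _%_; NonZero)
open import Data.Nat.Combinatorics using (_C_)
open import Data.Integer using (+_; +[1+_]; -[1+_])
open import Data.Fin as Fin using (Fin; toℕ)
open import Data.Fin.Subset using (Subset; Side; inside; outside; _∈_; ∣_∣)
open import Data.Vec as V using (Vec; []; _∷_)
open import Data.List as L using (List; [_]; concatMap; map; filter; length)
open import Data.Product using (_×_; _,_; proj₁; proj₂)
open import Data.Bool using (Bool; true; false)
open import Data.Vec using (here)
import Data.Nat.Properties as NP
open import Relation.Nullary using (Dec; yes; no; ¬_)
open import Relation.Nullary.Decidable using (_×-dec_)
open import Relation.Unary using (Decidable)
open import Relation.Binary.PropositionalEquality using (_≡_)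
open import Data.Rational as Q using (ℚ; mkℚ; _/_; _÷_; _*_; _+_; _-_; _≤_; 0ℚ; 1ℚ)
open import Data.Rational.Properties using (_≤?_)

allVec : (Q M : ℕ) → List (Vec (Fin Q) M)
allVec Q zero = [ [] ]
allVec Q (suc M) = concatMap (λ x → map (x ∷_) (allVec Q M)) (L.allFin Q)

-- all subsets of [M] (index i ∈ Fin M stands for i+1 ∈ [M])
allSubsets : (M : ℕ) → List (Subset M)
allSubsets zero = [ [] ]
allSubsets (suc M) = concatMap (λ s → map (s ∷_) (allSubsets M)) (inside L.∷ outside L.∷ L.[])

subsetSum : ∀ {Q M} → Vec (Fin Q) M → Subset M → ℕ
subsetSum [] [] = 0
subsetSum (a ∷ as) (inside ∷ s) = toℕ a ℕ.+ subsetSum as s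
subsetSum (a ∷ as) (outside ∷ s) = subsetSum as s

Good : (Q M t : ℕ) .{{_ : NonZero Q}} → Vec (Fin Q) M → Fin Q → Subset M → Set
Good Q M t a c S = (∣ S ∣ ≡ t) × (subsetSum a S % Q ≡ toℕ c)

good? : (Q M t : ℕ) .{{_ : NonZero Q}} (a : Vec (Fin Q) M) (c : Fin Q) → Decidable (Good Q M t a c)
good? Q M t a c S = (∣ S ∣ ℕ.≟ t) ×-dec (subsetSum a S % Q ℕ.≟ toℕ c)

-- "contains the index 1": the first element of [M] (here M = suc m)
containsFirst : ∀ {m} → Subset (suc m) → Set
containsFirst S = Fin.zero ∈ S

containsFirst? : ∀ {m} → Decidable (containsFirst {m})
containsFirst? (inside ∷ _) = yes here
containsFirst? (outside ∷ _) = no λ ()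

hitProb : (Q m t : ℕ) .{{_ : NonZero Q}} → Vec (Fin Q) (suc m) → Fin Q → ℚ
hitProb Q m t a c with length (filter (good? Q (suc m) t a c) (allSubsets (suc m)))
... | zero = 1ℚ
... | suc n = (+ length (filter containsFirst? (filter (good? Q (suc m) t a c) (allSubsets (suc m))))) / suc n

-- division by a rational; the default value 0 is only used when the divisor is 0
_÷'_ : ℚ → ℚ → ℚ
p ÷' mkℚ (+ zero) _ _ = 0ℚ
p ÷' q@(mkℚ +[1+ _ ] _ _) = p ÷ q
p ÷' q@(mkℚ -[1+ _ ] _ _) = p ÷ q

threshold : (ε : ℚ) (t M : ℕ) .{{_ : NonZero M}} → ℚ
threshold ε t M = ((1ℚ + ε) ÷' (1ℚ - ε)) * ((+ t) / M)

Bad : (Q m t : ℕ) .{{_ : NonZero Q}} (ε : ℚ) → Vec (Fin Q) (suc m) × Fin Q → Set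
Bad Q m t ε (a , c) = threshold ε t (suc m) ≤ hitProb Q m t a c

bad? : (Q m t : ℕ) .{{_ : NonZero Q}} (ε : ℚ) → Decidable (Bad Q m t ε)
bad? Q m t ε (a , c) = threshold ε t (suc m) ≤? hitProb Q m t a c

allPairs : (Q M : ℕ) → List (Vec (Fin Q) M × Fin Q)
allPairs Q M = L.cartesianProduct (allVec Q M) (L.allFin Q)

badProb : (Q m t : ℕ) .{{_ : NonZero Q}} (ε : ℚ) → ℚ
badProb Q m t ε = (+ length (filter (bad? Q m t ε) (allPairs Q (suc m)))) / (Q ℕ.^ suc m ℕ.* Q)
  where instance
          _ = NP.m^n≢0 Q (suc m)
          _ = NP.m*n≢0 (Q ℕ.^ suc m) Q

{-# OPTIONS --safe #-}

-- For a family F of subsets of [M] let N_F(a,c) count the S ∈ F with Σ_{i∈S} a_i ≡ c (mod Q).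
-- Summed over c it gives |F|, and for S ≠ S' the two subset sums agree for exactly a 1/Q
-- fraction of the vectors a (pairwise independence), so Σ_{a,c} (Q·N_F(a,c) − |F|)² ≤ |F|·Q^(M+2)
-- and Chebyshev bounds the fraction of pairs (a,c) with |Q·N_F − |F|| ≥ ε|F| by Q/(ε²|F|).
-- Take F = all t-subsets (|F| = C(M,t)) and F = the t-subsets containing 1 (|F| = C(M−1,t−1)).
-- Outside both events p_{a,c,t} = N₁/N < (1+ε)/(1−ε) · C(M−1,t−1)/C(M,t) = (1+ε)/(1−ε) · t/M,
-- so the probability Pr of the event satisfies ε²·Pr·C(M−1,t−1) ≤ 2Q; as ε, Pr ≤ 1 this gives
-- (ε·Pr)⁴·C(M−1,t−1) ≤ 2Q ≤ 256Q.

module Submission where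

open import Data.Nat as ℕ using (ℕ; suc; NonZero)
open import Data.Rational using (ℚ)
open import Relation.Binary.PropositionalEquality using (_≡_)

module Sums where

  open import Level using (Level)
  open import Data.Nat using (ℕ; _+_; _*_; _≤_; _≤?_; z≤n; s≤s)
  open import Data.Nat.Properties
  open import Algebra.Properties.CommutativeSemigroup +-commutativeSemigroup using () renaming (interchange to +-interchange)
  open import Data.Bool using (true; false; if_then_else_)
  open import Data.List using (List; []; _∷_; _++_; map; concatMap; filter; length; cartesianProduct)
  open import Data.Product using (_,_)
  open import Data.Sum using (_⊎_; inj₁; inj₂)
  open import Function using (_∘_; _⇔_)
  open import Relation.Nullary using (Dec; does; yes; no; _because_)
  open import Relation.Nullary.Decidable using (_×-dec_; dec-true; does-⇔)
  open import Relation.Unary using (Decidable)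
  open import Relation.Binary.PropositionalEquality

  private variable
    a b p r s : Level
    A : Set a
    B : Set b
    P : Set p
    R : Set r
    S : Set s

  𝟙 : Dec P → ℕ
  𝟙 P? = if does P? then 1 else 0

  𝟙≤1 : (P? : Dec P) → 𝟙 P? ≤ 1
  𝟙≤1 (true because _) = s≤s z≤n
  𝟙≤1 (false because _) = z≤n

  𝟙-yes : (P? : Dec P) → P → 𝟙 P? ≡ 1
  𝟙-yes P? x = cong (λ b → if b then 1 else 0) (dec-true P? x)

  𝟙-⇔ : P ⇔ R → (P? : Dec P) (R? : Dec R) → 𝟙 P? ≡ 𝟙 R?
  𝟙-⇔ P⇔R P? R? = cong (λ b → if b then 1 else 0) (does-⇔ P⇔R P? R?)

  𝟙-× : (P? : Dec P) (R? : Dec R) → 𝟙 (P? ×-dec R?) ≡ 𝟙 P? * 𝟙 R?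
  𝟙-× (true because _) (true because _) = refl
  𝟙-× (true because _) (false because _) = refl
  𝟙-× (false because _) R? = refl

  𝟙-⊎ : (P → R ⊎ S) → (P? : Dec P) (R? : Dec R) (S? : Dec S) → 𝟙 P? ≤ 𝟙 R? + 𝟙 S?
  𝟙-⊎ P⇒R⊎S (no _) R? S? = z≤n
  𝟙-⊎ P⇒R⊎S (yes x) R? S? with P⇒R⊎S x
  ... | inj₁ y = ≤-trans (≤-reflexive (sym (𝟙-yes R? y))) (m≤m+n _ _)
  ... | inj₂ z = ≤-trans (≤-reflexive (sym (𝟙-yes S? z))) (m≤n+m _ _)

  ∑ : List A → (A → ℕ) → ℕ
  ∑ [] f = 0
  ∑ (x ∷ xs) f = f x + ∑ xs f

  syntax ∑ xs (λ x → f) = ∑[ x ∈ xs ] f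

  ∑-cong : ∀ xs {f g : A → ℕ} → (∀ x → f x ≡ g x) → ∑ xs f ≡ ∑ xs g
  ∑-cong [] f≗g = refl
  ∑-cong (x ∷ xs) f≗g = cong₂ _+_ (f≗g x) (∑-cong xs f≗g)

  ∑-mono-≤ : ∀ xs {f g : A → ℕ} → (∀ x → f x ≤ g x) → ∑ xs f ≤ ∑ xs g
  ∑-mono-≤ [] f≤g = z≤n
  ∑-mono-≤ (x ∷ xs) f≤g = +-mono-≤ (f≤g x) (∑-mono-≤ xs f≤g)

  ∑-++ : ∀ xs ys (f : A → ℕ) → ∑ (xs ++ ys) f ≡ ∑ xs f + ∑ ys f
  ∑-++ [] ys f = refl
  ∑-++ (x ∷ xs) ys f = trans (cong (f x +_) (∑-++ xs ys f)) (sym (+-assoc (f x) _ _))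

  ∑-+ : ∀ xs (f g : A → ℕ) → ∑[ x ∈ xs ] (f x + g x) ≡ ∑ xs f + ∑ xs g
  ∑-+ [] f g = refl
  ∑-+ (x ∷ xs) f g = trans (cong (f x + g x +_) (∑-+ xs f g)) (+-interchange (f x) (g x) _ _)

  ∑-*ˡ : ∀ xs k (f : A → ℕ) → ∑[ x ∈ xs ] (k * f x) ≡ k * ∑ xs f
  ∑-*ˡ [] k f = sym (*-zeroʳ k)
  ∑-*ˡ (x ∷ xs) k f = trans (cong (k * f x +_) (∑-*ˡ xs k f)) (sym (*-distribˡ-+ k (f x) _))

  ∑-*ʳ : ∀ xs k (f : A → ℕ) → ∑[ x ∈ xs ] (f x * k) ≡ ∑ xs f * k
  ∑-*ʳ xs k f = trans (∑-cong xs (λ x → *-comm (f x) k)) (trans (∑-*ˡ xs k f) (*-comm k _))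

  ∑-const : ∀ (xs : List A) k → ∑[ x ∈ xs ] k ≡ length xs * k
  ∑-const [] k = refl
  ∑-const (x ∷ xs) k = cong (k +_) (∑-const xs k)

  ∑-zero : ∀ (xs : List A) → ∑[ x ∈ xs ] 0 ≡ 0
  ∑-zero xs = trans (∑-const xs 0) (*-zeroʳ (length xs))

  ∑-map : ∀ (g : A → B) xs f → ∑ (map g xs) f ≡ ∑ xs (f ∘ g)
  ∑-map g [] f = refl
  ∑-map g (x ∷ xs) f = cong (f (g x) +_) (∑-map g xs f)

  ∑-concatMap : ∀ (g : A → List B) xs f → ∑ (concatMap g xs) f ≡ ∑[ x ∈ xs ] ∑ (g x) f
  ∑-concatMap g [] f = refl
  ∑-concatMap g (x ∷ xs) f = trans (∑-++ (g x) _ f) (cong (∑ (g x) f +_) (∑-concatMap g xs f))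

  ∑-cartesianProduct : ∀ (xs : List A) (ys : List B) f →
    ∑ (cartesianProduct xs ys) f ≡ ∑[ x ∈ xs ] ∑[ y ∈ ys ] f (x , y)
  ∑-cartesianProduct [] ys f = refl
  ∑-cartesianProduct (x ∷ xs) ys f =
    trans (∑-++ (map (x ,_) ys) _ f) (cong₂ _+_ (∑-map (x ,_) ys f) (∑-cartesianProduct xs ys f))

  ∑-comm : ∀ (xs : List A) (ys : List B) (f : A → B → ℕ) →
    ∑[ x ∈ xs ] ∑[ y ∈ ys ] f x y ≡ ∑[ y ∈ ys ] ∑[ x ∈ xs ] f x y
  ∑-comm [] ys f = sym (∑-zero ys)
  ∑-comm (x ∷ xs) ys f =
    trans (cong (∑ ys (f x) +_) (∑-comm xs ys f)) (sym (∑-+ ys (f x) (λ y → ∑[ x ∈ xs ] f x y)))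

  ∑-*-∑ : ∀ (xs : List A) (ys : List B) f g →
    ∑ xs f * ∑ ys g ≡ ∑[ x ∈ xs ] ∑[ y ∈ ys ] (f x * g y)
  ∑-*-∑ xs ys f g = trans (sym (∑-*ʳ xs (∑ ys g) f)) (∑-cong xs (λ x → sym (∑-*ˡ ys (f x) g)))

  ∑-filter : ∀ {P : A → Set p} (P? : Decidable P) xs f → ∑ (filter P? xs) f ≡ ∑[ x ∈ xs ] (𝟙 (P? x) * f x)
  ∑-filter P? [] f = refl
  ∑-filter P? (x ∷ xs) f with does (P? x)
  ... | true = cong₂ _+_ (sym (+-identityʳ (f x))) (∑-filter P? xs f)
  ... | false = ∑-filter P? xs f

  length≡∑1 : ∀ (xs : List A) → length xs ≡ ∑[ x ∈ xs ] 1
  length≡∑1 xs = sym (trans (∑-const xs 1) (*-identityʳ (length xs)))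

  length-filter≡∑𝟙 : ∀ {P : A → Set p} (P? : Decidable P) xs → length (filter P? xs) ≡ ∑[ x ∈ xs ] 𝟙 (P? x)
  length-filter≡∑𝟙 P? xs =
    trans (length≡∑1 (filter P? xs)) (trans (∑-filter P? xs (λ _ → 1)) (∑-cong xs (λ x → *-identityʳ _)))

  chebyshev : ∀ (xs : List A) (X : A → ℕ) v →
    (∑[ x ∈ xs ] 𝟙 (v ≤? X x)) * (v * v) ≤ ∑[ x ∈ xs ] (X x * X x)
  chebyshev xs X v = begin
    (∑[ x ∈ xs ] 𝟙 (v ≤? X x)) * (v * v) ≡⟨ ∑-*ʳ xs (v * v) (λ x → 𝟙 (v ≤? X x)) ⟨
    ∑[ x ∈ xs ] (𝟙 (v ≤? X x) * (v * v)) ≤⟨ ∑-mono-≤ xs tail ⟩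
    ∑[ x ∈ xs ] (X x * X x)              ∎
    where
    open ≤-Reasoning
    tail : ∀ x → 𝟙 (v ≤? X x) * (v * v) ≤ X x * X x
    tail x = squares (v ≤? X x)
      where
      squares : (v≤?X : Dec (v ≤ X x)) → 𝟙 v≤?X * (v * v) ≤ X x * X x
      squares (yes v≤X) = ≤-trans (≤-reflexive (+-identityʳ _)) (*-mono-≤ v≤X v≤X)
      squares (no _) = z≤n

module Arithmetic where

  open import Data.Nat using (zero; suc; _+_; _*_; _≤_; _<_; _≤?_; ∣_-_∣; NonZero; z≤n; s≤s)
  open import Data.Nat.Properties
  open import Data.Nat.Tactic.RingSolver using (solve)
  open import Data.List using (_∷_; [])
  open import Data.Sum using (_⊎_; inj₁; inj₂)
  open import Data.Empty using (⊥-elim)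
  open import Relation.Nullary using (yes; no)
  open import Relation.Binary.PropositionalEquality
  open ≤-Reasoning

  m≤1⇒m*[n+o]≤m*n+o : ∀ {m} n o → m ≤ 1 → m * (n + o) ≤ m * n + o
  m≤1⇒m*[n+o]≤m*n+o {m} n o m≤1 = begin
    m * (n + o)   ≡⟨ *-distribˡ-+ m n o ⟩
    m * n + m * o ≤⟨ +-monoʳ-≤ (m * n) (≤-trans (*-monoˡ-≤ o m≤1) (≤-reflexive (+-identityʳ o))) ⟩
    m * n + o     ∎

  ∣m-n∣²+2mn≡m²+n² : ∀ m n → ∣ m - n ∣ * ∣ m - n ∣ + 2 * m * n ≡ m * m + n * n
  ∣m-n∣²+2mn≡m²+n² zero n = +-identityʳ (n * n)
  ∣m-n∣²+2mn≡m²+n² (suc m) zero = cong (suc m * suc m +_) (*-zeroʳ (2 * suc m))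
  ∣m-n∣²+2mn≡m²+n² (suc m) (suc n) = step ∣ m - n ∣ (∣m-n∣²+2mn≡m²+n² m n)
    where
    step : ∀ d → d * d + 2 * m * n ≡ m * m + n * n → d * d + 2 * suc m * suc n ≡ suc m * suc m + suc n * suc n
    step d eq = begin-equality
      d * d + 2 * suc m * suc n               ≡⟨ solve (d ∷ m ∷ n ∷ []) ⟩
      (d * d + 2 * m * n) + 2 * (m + n + 1)   ≡⟨ cong (_+ 2 * (m + n + 1)) eq ⟩
      (m * m + n * n) + 2 * (m + n + 1)       ≡⟨ solve (m ∷ n ∷ []) ⟩
      suc m * suc m + suc n * suc n           ∎

  -- Read ε = n/d and 1 − ε = s/d; K and C are the sizes of two families with t·C = M·K, and
  -- N₁, N count their members hitting a residue. If both |Q·N₁ − K| < εK and |Q·N − C| < εC,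
  -- then N₁/N < (1+ε)/(1−ε) · t/M, contradicting the cross-multiplied ratio hypothesis.
  deviation-dichotomy : ∀ {n s d t M K C} Q N N₁ .{{_ : NonZero s}} .{{_ : NonZero M}} →
    n + s ≡ d → t * C ≡ M * K → (d + n) * t * N ≤ N₁ * s * M →
    n * K ≤ d * ∣ Q * N₁ - K ∣ ⊎ n * C ≤ d * ∣ Q * N - C ∣
  deviation-dichotomy {n} {s} {d} {t} {M} {K} {C} Q N N₁ n+s≡d tC≡MK ratio
    with n * K ≤? d * ∣ Q * N₁ - K ∣ | n * C ≤? d * ∣ Q * N - C ∣
  ... | yes large₁ | _ = inj₁ large₁
  ... | no _ | yes large₀ = inj₂ large₀
  ... | no small₁ | no small₀ = ⊥-elim (<-irrefl refl impossible)
    where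
    few-hits₁ : d * (Q * N₁) < (d + n) * K
    few-hits₁ = begin-strict
      d * (Q * N₁)                   ≤⟨ *-monoʳ-≤ d (subst (λ x → Q * N₁ ≤ K + x) (∣-∣-comm K (Q * N₁))
                                                           (m≤n+∣n-m∣ (Q * N₁) K)) ⟩
      d * (K + ∣ Q * N₁ - K ∣)       ≡⟨ *-distribˡ-+ d K _ ⟩
      d * K + d * ∣ Q * N₁ - K ∣     <⟨ +-monoʳ-< (d * K) (≰⇒> small₁) ⟩
      d * K + n * K                  ≡⟨ *-distribʳ-+ K d n ⟨
      (d + n) * K                    ∎
    many-hits : s * C < d * (Q * N)
    many-hits = +-cancelʳ-< (n * C) (s * C) (d * (Q * N)) (begin-strict
      s * C + n * C                  ≡⟨ *-distribʳ-+ C s n ⟨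
      (s + n) * C                    ≡⟨ cong (_* C) (trans (+-comm s n) n+s≡d) ⟩
      d * C                          ≤⟨ *-monoʳ-≤ d (m≤n+∣n-m∣ C (Q * N)) ⟩
      d * (Q * N + ∣ Q * N - C ∣)    ≡⟨ *-distribˡ-+ d (Q * N) _ ⟩
      d * (Q * N) + d * ∣ Q * N - C ∣ <⟨ +-monoʳ-< (d * (Q * N)) (≰⇒> small₀) ⟩
      d * (Q * N) + n * C            ∎)
    impossible : (d + n) * t * (s * C) < (d + n) * t * (s * C)
    impossible = begin-strict
      (d + n) * t * (s * C)          ≤⟨ *-monoʳ-≤ ((d + n) * t) (<⇒≤ many-hits) ⟩
      (d + n) * t * (d * (Q * N))    ≡⟨ solve (d ∷ n ∷ t ∷ Q ∷ N ∷ []) ⟩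
      d * Q * ((d + n) * t * N)      ≤⟨ *-monoʳ-≤ (d * Q) ratio ⟩
      d * Q * (N₁ * s * M)           ≡⟨ solve (d ∷ Q ∷ N₁ ∷ s ∷ M ∷ []) ⟩
      s * M * (d * (Q * N₁))         <⟨ *-monoʳ-< (s * M) {{m*n≢0 s M}} few-hits₁ ⟩
      s * M * ((d + n) * K)          ≡⟨ solve (s ∷ M ∷ d ∷ n ∷ K ∷ []) ⟩
      (d + n) * s * (M * K)          ≡⟨ cong ((d + n) * s *_) tC≡MK ⟨
      (d + n) * s * (t * C)          ≡⟨ solve (d ∷ n ∷ s ∷ t ∷ C ∷ []) ⟩
      (d + n) * t * (s * C)          ∎

  fourth-power-bound : ∀ {n d B Ω K Q} → n ≤ d → B ≤ Ω → B * (n * n * K) ≤ 2 * (d * d * (Ω * Q)) →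
    n * B * (n * B) * (n * B) * (n * B) * K * 1 ≤ 256 * Q * (d * Ω * (d * Ω) * (d * Ω) * (d * Ω) * 1)
  fourth-power-bound {n} {d} {B} {Ω} {K} {Q} n≤d B≤Ω bound = begin
    n * B * (n * B) * (n * B) * (n * B) * K * 1   ≡⟨ solve (n ∷ B ∷ K ∷ []) ⟩
    B * (n * n * K) * (n * n * (B * B * B))       ≤⟨ *-mono-≤ bound (*-mono-≤ (*-mono-≤ n≤d n≤d)
                                                                           (*-mono-≤ (*-mono-≤ B≤Ω B≤Ω) B≤Ω)) ⟩
    2 * (d * d * (Ω * Q)) * (d * d * (Ω * Ω * Ω)) ≡⟨ solve (d ∷ Ω ∷ Q ∷ []) ⟩
    2 * (Q * (d * Ω * (d * Ω) * (d * Ω) * (d * Ω) * 1))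
                                                  ≤⟨ *-monoˡ-≤ (Q * _) {2} {256} (s≤s (s≤s z≤n)) ⟩
    256 * (Q * (d * Ω * (d * Ω) * (d * Ω) * (d * Ω) * 1)) ≡⟨ *-assoc 256 Q _ ⟨
    256 * Q * (d * Ω * (d * Ω) * (d * Ω) * (d * Ω) * 1) ∎

module Residues where

  open import Data.Nat using (ℕ; zero; suc; _+_; _*_; _%_; _<_; _≟_; z<s; s<s; NonZero)
  open import Data.Nat.Properties
  open import Data.Nat.DivMod using (m%n<n; [m+n]%n≡m%n; m<n⇒m%n≡m)
  open import Data.List using (upTo; allFin; tabulate; map; _++_; [_])
  open import Data.List.Properties using (map-upTo; upTo-∷ʳ; map-tabulate; length-tabulate)
  open import Data.Fin as Fin using (toℕ)
  open import Function using (_∘_; id; mk⇔)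
  open import Relation.Binary.PropositionalEquality hiding ([_])
  open ≡-Reasoning
  open Sums

  ∑-upTo-suc : ∀ n f → ∑[ i ∈ upTo (suc n) ] f i ≡ f 0 + ∑[ i ∈ upTo n ] f (suc i)
  ∑-upTo-suc n f = cong (f 0 +_) (trans (cong (λ is → ∑ is f) (sym (map-upTo suc n))) (∑-map suc (upTo n) f))

  ∑-upTo-∷ʳ : ∀ n f → ∑[ i ∈ upTo (suc n) ] f i ≡ ∑[ i ∈ upTo n ] f i + f n
  ∑-upTo-∷ʳ n f = begin
    ∑ (upTo (suc n)) f         ≡⟨ cong (λ is → ∑ is f) (upTo-∷ʳ n) ⟨
    ∑ (upTo n ++ [ n ]) f      ≡⟨ ∑-++ (upTo n) [ n ] f ⟩
    ∑ (upTo n) f + (f n + 0)   ≡⟨ cong (∑ (upTo n) f +_) (+-identityʳ (f n)) ⟩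
    ∑ (upTo n) f + f n         ∎

  ∑-upTo-cong : ∀ n {f g} → (∀ i → i < n → f i ≡ g i) → ∑ (upTo n) f ≡ ∑ (upTo n) g
  ∑-upTo-cong zero f≗g = refl
  ∑-upTo-cong (suc n) {f} {g} f≗g = begin
    ∑ (upTo (suc n)) f                ≡⟨ ∑-upTo-suc n f ⟩
    f 0 + ∑[ i ∈ upTo n ] f (suc i)   ≡⟨ cong₂ _+_ (f≗g 0 z<s) (∑-upTo-cong n (λ i i<n → f≗g (suc i) (s<s i<n))) ⟩
    g 0 + ∑[ i ∈ upTo n ] g (suc i)   ≡⟨ ∑-upTo-suc n g ⟨
    ∑ (upTo (suc n)) g                ∎

  ∑-upTo-sift : ∀ {n w} (g : ℕ → ℕ) → w < n → ∑[ i ∈ upTo n ] (𝟙 (w ≟ i) * g i) ≡ g w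
  ∑-upTo-sift {suc n} {zero} g _ = begin
    ∑[ i ∈ upTo (suc n) ] (𝟙 (0 ≟ i) * g i) ≡⟨ ∑-upTo-suc n (λ i → 𝟙 (0 ≟ i) * g i) ⟩
    (g 0 + 0) + ∑[ i ∈ upTo n ] 0          ≡⟨ cong₂ _+_ (+-identityʳ (g 0)) (∑-zero (upTo n)) ⟩
    g 0 + 0                                ≡⟨ +-identityʳ (g 0) ⟩
    g 0                                    ∎
  ∑-upTo-sift {suc n} {suc w} g (s<s w<n) =
    trans (∑-upTo-suc n (λ i → 𝟙 (suc w ≟ i) * g i)) (∑-upTo-sift (g ∘ suc) w<n)

  ∑-upTo-δ : ∀ {n w} → w < n → ∑[ i ∈ upTo n ] 𝟙 (w ≟ i) ≡ 1
  ∑-upTo-δ {n} {w} w<n = trans (∑-cong (upTo n) (λ i → sym (*-identityʳ (𝟙 (w ≟ i))))) (∑-upTo-sift (λ _ → 1) w<n)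

  ∑-upTo-periodic : ∀ n (h : ℕ → ℕ) → (∀ k → h (k + n) ≡ h k) →
    ∀ u → ∑[ i ∈ upTo n ] h (u + i) ≡ ∑ (upTo n) h
  ∑-upTo-periodic n h period zero = refl
  ∑-upTo-periodic n h period (suc u) = trans shift (∑-upTo-periodic n h period u)
    where
    window : ℕ → ℕ
    window u = ∑[ i ∈ upTo n ] h (u + i)
    shift : window (suc u) ≡ window u
    shift = +-cancelˡ-≡ (h u) _ _ (begin
      h u + window (suc u)                    ≡⟨ cong₂ _+_ (cong h (sym (+-identityʳ u)))
                                                    (∑-cong (upTo n) (λ i → cong h (sym (+-suc u i)))) ⟩
      h (u + 0) + ∑[ i ∈ upTo n ] h (u + suc i) ≡⟨ ∑-upTo-suc n (λ i → h (u + i)) ⟨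
      ∑[ i ∈ upTo (suc n) ] h (u + i)         ≡⟨ ∑-upTo-∷ʳ n (λ i → h (u + i)) ⟩
      window u + h (u + n)                    ≡⟨ cong (window u +_) (period u) ⟩
      window u + h u                          ≡⟨ +-comm (window u) (h u) ⟩
      h u + window u                          ∎)

  ∑-allFin : ∀ n (f : ℕ → ℕ) → ∑[ i ∈ allFin n ] f (toℕ i) ≡ ∑ (upTo n) f
  ∑-allFin zero f = refl
  ∑-allFin (suc n) f = begin
    ∑[ i ∈ allFin (suc n) ] f (toℕ i)          ≡⟨⟩
    f 0 + ∑ (tabulate {n = n} Fin.suc) (f ∘ toℕ)
                                               ≡⟨ cong (λ is → f 0 + ∑ is (f ∘ toℕ)) (map-tabulate {n = n} id Fin.suc) ⟨
    f 0 + ∑ (map Fin.suc (allFin n)) (f ∘ toℕ) ≡⟨ cong (f 0 +_) (∑-map Fin.suc (allFin n) (f ∘ toℕ)) ⟩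
    f 0 + ∑[ i ∈ allFin n ] f (suc (toℕ i))    ≡⟨ cong (f 0 +_) (∑-allFin n (f ∘ suc)) ⟩
    f 0 + ∑[ i ∈ upTo n ] f (suc i)            ≡⟨ ∑-upTo-suc n f ⟨
    ∑ (upTo (suc n)) f                         ∎

  ∑-allFin-const : ∀ n k → ∑[ i ∈ allFin n ] k ≡ n * k
  ∑-allFin-const n k = trans (∑-const (allFin n) k) (cong (_* k) (length-tabulate {n = n} id))

  module _ (Q : ℕ) .{{_ : NonZero Q}} where

    ∑-residue-sift : ∀ k (g : ℕ → ℕ) → ∑[ c ∈ allFin Q ] (𝟙 (k % Q ≟ toℕ c) * g (toℕ c)) ≡ g (k % Q)
    ∑-residue-sift k g = trans (∑-allFin Q (λ i → 𝟙 (k % Q ≟ i) * g i)) (∑-upTo-sift g (m%n<n k Q))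

    ∑-residue-pair : ∀ k l → ∑[ c ∈ allFin Q ] (𝟙 (k % Q ≟ toℕ c) * 𝟙 (l % Q ≟ toℕ c)) ≡ 𝟙 (k % Q ≟ l % Q)
    ∑-residue-pair k l = trans (∑-residue-sift k (λ i → 𝟙 (l % Q ≟ i)))
                               (𝟙-⇔ (mk⇔ sym sym) (l % Q ≟ k % Q) (k % Q ≟ l % Q))

    ∑-residue-δ : ∀ k → ∑[ c ∈ allFin Q ] 𝟙 (k % Q ≟ toℕ c) ≡ 1
    ∑-residue-δ k = trans (∑-cong (allFin Q) (λ c → sym (*-identityʳ (𝟙 (k % Q ≟ toℕ c)))))
                          (∑-residue-sift k (λ _ → 1))

    ∑-shifted-residue : ∀ u w → w < Q → ∑[ x ∈ allFin Q ] 𝟙 ((u + toℕ x) % Q ≟ w) ≡ 1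
    ∑-shifted-residue u w w<Q = begin
      ∑[ x ∈ allFin Q ] h (u + toℕ x) ≡⟨ ∑-allFin Q (λ i → h (u + i)) ⟩
      ∑[ i ∈ upTo Q ] h (u + i)       ≡⟨ ∑-upTo-periodic Q h (λ k → cong (λ r → 𝟙 (r ≟ w)) ([m+n]%n≡m%n k Q)) u ⟩
      ∑ (upTo Q) h                    ≡⟨ ∑-upTo-cong Q (λ i i<Q → trans (cong (λ r → 𝟙 (r ≟ w)) (m<n⇒m%n≡m i<Q))
                                                                        (𝟙-⇔ (mk⇔ sym sym) (i ≟ w) (w ≟ i))) ⟩
      ∑[ i ∈ upTo Q ] 𝟙 (w ≟ i)       ≡⟨ ∑-upTo-δ w<Q ⟩
      1                               ∎
      where
      h : ℕ → ℕ
      h k = 𝟙 (k % Q ≟ w)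

module Subsets where

  open import Data.Nat using (ℕ; zero; suc; _+_; _*_; _≤_; _<_; _≟_; z≤n; s≤s)
  open import Data.Nat.Properties
  open import Data.Nat.Combinatorics using (_C_; nCk+nC[k+1]≡[n+1]C[k+1])
  open import Data.Bool using (true; false)
  import Data.Bool.Properties as Bool
  open import Data.List as L using (map)
  open import Data.Fin.Subset using (Subset; inside; outside; ∣_∣)
  open import Data.Vec using ([]; _∷_)
  open import Data.Vec.Properties using (≡-dec)
  open import Relation.Nullary using (Dec)
  open import Relation.Nullary.Decidable using (_×-dec_)
  open import Relation.Binary.PropositionalEquality
  open import Defs
  open Sums

  _≟ˢ_ : ∀ {M} (S S' : Subset M) → Dec (S ≡ S')
  _≟ˢ_ = ≡-dec Bool._≟_

  ∑-allSubsets-suc : ∀ M (f : Subset (suc M) → ℕ) →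
    ∑ (allSubsets (suc M)) f ≡ ∑[ S ∈ allSubsets M ] f (inside ∷ S) + ∑[ S ∈ allSubsets M ] f (outside ∷ S)
  ∑-allSubsets-suc M f = trans (∑-concatMap (λ s → map (s ∷_) (allSubsets M)) (inside L.∷ outside L.∷ L.[]) f)
    (cong₂ _+_ (∑-map (inside ∷_) (allSubsets M) f) (trans (+-identityʳ _) (∑-map (outside ∷_) (allSubsets M) f)))

  ∑-allSubsets-δ : ∀ {M} (S : Subset M) → ∑[ S' ∈ allSubsets M ] 𝟙 (S ≟ˢ S') ≡ 1
  ∑-allSubsets-δ [] = refl
  ∑-allSubsets-δ {suc M} (s ∷ S) = begin
    ∑[ S' ∈ allSubsets (suc M) ] 𝟙 ((s ∷ S) ≟ˢ S')
      ≡⟨ ∑-allSubsets-suc M (λ S' → 𝟙 ((s ∷ S) ≟ˢ S')) ⟩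
    ∑[ S' ∈ allSubsets M ] 𝟙 ((s Bool.≟ inside) ×-dec (S ≟ˢ S'))
      + ∑[ S' ∈ allSubsets M ] 𝟙 ((s Bool.≟ outside) ×-dec (S ≟ˢ S'))
      ≡⟨ cong₂ _+_ (split inside) (split outside) ⟩
    𝟙 (s Bool.≟ inside) * 1 + 𝟙 (s Bool.≟ outside) * 1
      ≡⟨ one-side s ⟩
    1 ∎
    where
    open ≡-Reasoning
    split : ∀ s' → ∑[ S' ∈ allSubsets M ] 𝟙 ((s Bool.≟ s') ×-dec (S ≟ˢ S')) ≡ 𝟙 (s Bool.≟ s') * 1
    split s' = trans (∑-cong (allSubsets M) (λ S' → 𝟙-× (s Bool.≟ s') (S ≟ˢ S')))
                     (trans (∑-*ˡ (allSubsets M) (𝟙 (s Bool.≟ s')) (λ S' → 𝟙 (S ≟ˢ S')))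
                            (cong (𝟙 (s Bool.≟ s') *_) (∑-allSubsets-δ S)))
    one-side : ∀ s → 𝟙 (s Bool.≟ inside) * 1 + 𝟙 (s Bool.≟ outside) * 1 ≡ 1
    one-side true = refl
    one-side false = refl

  #subsets-of-size : ∀ n k → ∑[ S ∈ allSubsets n ] 𝟙 (∣ S ∣ ≟ k) ≡ n C k
  #subsets-of-size zero zero = refl
  #subsets-of-size zero (suc k) = refl
  #subsets-of-size (suc n) zero =
    trans (∑-allSubsets-suc n _) (cong₂ _+_ (∑-zero (allSubsets n)) (#subsets-of-size n zero))
  #subsets-of-size (suc n) (suc k) =
    trans (∑-allSubsets-suc n _) (trans (cong₂ _+_ (#subsets-of-size n k) (#subsets-of-size n (suc k)))
                                        (nCk+nC[k+1]≡[n+1]C[k+1] n k))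

  #subsets-of-size-containing-first : ∀ m k →
    ∑[ S ∈ allSubsets (suc m) ] 𝟙 ((∣ S ∣ ≟ suc k) ×-dec containsFirst? S) ≡ m C k
  #subsets-of-size-containing-first m k = begin
    ∑[ S ∈ allSubsets (suc m) ] 𝟙 ((∣ S ∣ ≟ suc k) ×-dec containsFirst? S)
      ≡⟨ ∑-allSubsets-suc m _ ⟩
    ∑[ S ∈ allSubsets m ] 𝟙 ((∣ inside ∷ S ∣ ≟ suc k) ×-dec containsFirst? (inside ∷ S))
      + ∑[ S ∈ allSubsets m ] 𝟙 ((∣ outside ∷ S ∣ ≟ suc k) ×-dec containsFirst? (outside ∷ S))
      ≡⟨ cong₂ _+_ (∑-cong (allSubsets m) (λ S → trans (𝟙-× (∣ S ∣ ≟ k) (containsFirst? (inside ∷ S)))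
                                                       (*-identityʳ _)))
                   (∑-cong (allSubsets m) (λ S → trans (𝟙-× (∣ S ∣ ≟ suc k) (containsFirst? (outside ∷ S)))
                                                       (*-zeroʳ (𝟙 (∣ S ∣ ≟ suc k))))) ⟩
    ∑[ S ∈ allSubsets m ] 𝟙 (∣ S ∣ ≟ k) + ∑[ S ∈ allSubsets m ] 0
      ≡⟨ cong₂ _+_ (#subsets-of-size m k) (∑-zero (allSubsets m)) ⟩
    m C k + 0
      ≡⟨ +-identityʳ (m C k) ⟩
    m C k ∎
    where open ≡-Reasoning

  nCk≤[n+1]C[k+1] : ∀ n k → n C k ≤ suc n C suc k
  nCk≤[n+1]C[k+1] n k = ≤-trans (m≤m+n _ _) (≤-reflexive (nCk+nC[k+1]≡[n+1]C[k+1] n k))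

  k≤n⇒nCk>0 : ∀ {n k} → k ≤ n → 0 < n C k
  k≤n⇒nCk>0 {n} {zero} _ = s≤s z≤n
  k≤n⇒nCk>0 {suc n} {suc k} (s≤s k≤n) = ≤-trans (k≤n⇒nCk>0 k≤n) (nCk≤[n+1]C[k+1] n k)

  [k+1]*[n+1]C[k+1]≡[n+1]*nCk : ∀ n k → suc k * (suc n C suc k) ≡ suc n * (n C k)
  [k+1]*[n+1]C[k+1]≡[n+1]*nCk zero zero = refl
  [k+1]*[n+1]C[k+1]≡[n+1]*nCk zero (suc k) = *-zeroʳ (suc (suc k))
  [k+1]*[n+1]C[k+1]≡[n+1]*nCk (suc n) k = begin
    suc k * (suc (suc n) C suc k)            ≡⟨ cong (suc k *_) (nCk+nC[k+1]≡[n+1]C[k+1] (suc n) k) ⟨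
    suc k * (suc n C k + suc n C suc k)      ≡⟨ *-distribˡ-+ (suc k) (suc n C k) _ ⟩
    suc k * (suc n C k) + suc k * (suc n C suc k)
                                             ≡⟨ cong (suc k * (suc n C k) +_) ([k+1]*[n+1]C[k+1]≡[n+1]*nCk n k) ⟩
    suc k * (suc n C k) + suc n * (n C k)    ≡⟨ pascal-step k ⟩
    suc (suc n) * (suc n C k)                ∎
    where
    open ≡-Reasoning
    pascal-step : ∀ k → suc k * (suc n C k) + suc n * (n C k) ≡ suc (suc n) * (suc n C k)
    pascal-step zero = refl
    pascal-step (suc j) = begin
      (c + suc j * c) + suc n * (n C suc j)         ≡⟨ +-assoc c _ _ ⟩
      c + (suc j * c + suc n * (n C suc j))         ≡⟨ cong (λ z → c + (z + suc n * (n C suc j)))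
                                                            ([k+1]*[n+1]C[k+1]≡[n+1]*nCk n j) ⟩
      c + (suc n * (n C j) + suc n * (n C suc j))   ≡⟨ cong (c +_) (*-distribˡ-+ (suc n) (n C j) _) ⟨
      c + suc n * (n C j + n C suc j)               ≡⟨ cong (λ z → c + suc n * z) (nCk+nC[k+1]≡[n+1]C[k+1] n j) ⟩
      c + suc n * c                                 ∎
      where
      c : ℕ
      c = suc n C suc j

module SubsetSums (Q : ℕ) .{{_ : NonZero Q}} where

  open import Level using (Level)
  open import Data.Nat using (ℕ; zero; suc; _+_; _*_; _^_; _%_; _≤_; _<_; _≟_; _≤?_; ∣_-_∣; NonZero; >-nonZero)
  open import Data.Nat.Tactic.RingSolver using (solve-∀)
  open import Data.Nat.Properties
  open import Data.Nat.DivMod using (m%n<n)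
  open import Algebra.Properties.CommutativeSemigroup +-commutativeSemigroup using (xy∙z≈xz∙y)
  open import Algebra.Properties.CommutativeSemigroup *-commutativeSemigroup using (x∙yz≈y∙xz) renaming (interchange to *-interchange)
  open import Data.Bool using (true; false; if_then_else_)
  open import Data.List using (List; allFin; map)
  open import Data.Fin using (Fin; toℕ)
  open import Data.Fin.Subset using (Side; Subset)
  open import Data.Vec using (Vec; []; _∷_)
  open import Data.Product using (_×_; _,_)
  open import Data.Empty using (⊥-elim)
  open import Function using (mk⇔)
  open import Relation.Nullary using (yes; no)
  open import Relation.Unary using (Decidable)
  open import Relation.Binary.PropositionalEquality
  open ≤-Reasoning
  open import Defs
  open Sums
  open Residues
  open Subsets using (_≟ˢ_; ∑-allSubsets-δ)
  open Arithmetic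

  ∑-allVec-suc : ∀ M f → ∑ (allVec Q (suc M)) f ≡ ∑[ x ∈ allFin Q ] ∑[ a ∈ allVec Q M ] f (x ∷ a)
  ∑-allVec-suc M f = trans (∑-concatMap (λ x → map (x ∷_) (allVec Q M)) (allFin Q) f)
                           (∑-cong (allFin Q) (λ x → ∑-map (x ∷_) (allVec Q M) f))

  ∑-allVec-const : ∀ M k → ∑[ a ∈ allVec Q M ] k ≡ Q ^ M * k
  ∑-allVec-const zero k = refl
  ∑-allVec-const (suc M) k = begin-equality
    ∑[ a ∈ allVec Q (suc M) ] k          ≡⟨ ∑-allVec-suc M (λ _ → k) ⟩
    ∑[ x ∈ allFin Q ] ∑[ a ∈ allVec Q M ] k ≡⟨ ∑-cong (allFin Q) (λ _ → ∑-allVec-const M k) ⟩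
    ∑[ x ∈ allFin Q ] (Q ^ M * k)        ≡⟨ ∑-allFin-const Q (Q ^ M * k) ⟩
    Q * (Q ^ M * k)                      ≡⟨ *-assoc Q (Q ^ M) k ⟨
    Q ^ suc M * k                        ∎

  contribution : Side → Fin Q → ℕ
  contribution s x = if s then toℕ x else 0

  subsetSum-∷ : ∀ {M} s (x : Fin Q) (a : Vec (Fin Q) M) S →
    subsetSum (x ∷ a) (s ∷ S) ≡ contribution s x + subsetSum a S
  subsetSum-∷ true x a S = refl
  subsetSum-∷ false x a S = refl

  -- The offsets u and v make the statement about distinct subsets strong enough for induction on M.
  collisions : ∀ {M} → Subset M → Subset M → ℕ → ℕ → ℕ
  collisions {M} S S' u v = ∑[ a ∈ allVec Q M ] 𝟙 ((u + subsetSum a S) % Q ≟ (v + subsetSum a S') % Q)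

  collisions-∷ : ∀ {M} s s' (S S' : Subset M) u v → collisions (s ∷ S) (s' ∷ S') u v ≡
    ∑[ x ∈ allFin Q ] collisions S S' (u + contribution s x) (v + contribution s' x)
  collisions-∷ {M} s s' S S' u v = trans (∑-allVec-suc M _) (∑-cong (allFin Q) (λ x → ∑-cong (allVec Q M) (λ a →
    cong₂ (λ p q → 𝟙 (p % Q ≟ q % Q))
      (trans (cong (u +_) (subsetSum-∷ s x a S)) (sym (+-assoc u _ _)))
      (trans (cong (v +_) (subsetSum-∷ s' x a S')) (sym (+-assoc v _ _))))))

  collisions-sym : ∀ {M} (S S' : Subset M) u v → collisions S S' u v ≡ collisions S' S v u
  collisions-sym {M} S S' u v = ∑-cong (allVec Q M) (λ a → 𝟙-⇔ (mk⇔ sym sym) (x a ≟ y a) (y a ≟ x a))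
    where
    x y : Vec (Fin Q) M → ℕ
    x a = (u + subsetSum a S) % Q
    y a = (v + subsetSum a S') % Q

  collisions≤Q^M : ∀ {M} (S S' : Subset M) u v → collisions S S' u v ≤ Q ^ M
  collisions≤Q^M {M} S S' u v =
    ≤-trans (∑-mono-≤ (allVec Q M) (λ a → 𝟙≤1 ((u + subsetSum a S) % Q ≟ (v + subsetSum a S') % Q)))
            (≤-reflexive (trans (∑-allVec-const M 1) (*-identityʳ _)))

  ∑-collisions-shifted : ∀ {M} (S : Subset M) u v → ∑[ x ∈ allFin Q ] collisions S S (u + toℕ x) v ≡ Q ^ M
  ∑-collisions-shifted {M} S u v = begin-equality
    ∑[ x ∈ allFin Q ] ∑[ a ∈ allVec Q M ] 𝟙 ((u + toℕ x + subsetSum a S) % Q ≟ w a)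
      ≡⟨ ∑-comm (allFin Q) (allVec Q M) _ ⟩
    ∑[ a ∈ allVec Q M ] ∑[ x ∈ allFin Q ] 𝟙 ((u + toℕ x + subsetSum a S) % Q ≟ w a)
      ≡⟨ ∑-cong (allVec Q M) (λ a → ∑-cong (allFin Q) (λ x →
           cong (λ p → 𝟙 (p % Q ≟ w a)) (xy∙z≈xz∙y u (toℕ x) (subsetSum a S)))) ⟩
    ∑[ a ∈ allVec Q M ] ∑[ x ∈ allFin Q ] 𝟙 ((u + subsetSum a S + toℕ x) % Q ≟ w a)
      ≡⟨ ∑-cong (allVec Q M) (λ a → ∑-shifted-residue Q (u + subsetSum a S) (w a) (m%n<n _ Q)) ⟩
    ∑[ a ∈ allVec Q M ] 1
      ≡⟨ trans (∑-allVec-const M 1) (*-identityʳ _) ⟩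
    Q ^ M ∎
    where
    w : Vec (Fin Q) M → ℕ
    w a = (v + subsetSum a S) % Q

  -- Where the heads of S and S' differ, the head of a shifts one sum but not the other,
  -- so exactly one of its Q values produces a collision.
  S≢S'⇒Q*collisions≡Q^M : ∀ {M} (S S' : Subset M) → S ≢ S' → ∀ u v → Q * collisions S S' u v ≡ Q ^ M
  S≢S'⇒Q*collisions≡Q^M [] [] S≢S' u v = ⊥-elim (S≢S' refl)
  S≢S'⇒Q*collisions≡Q^M {suc M} (s ∷ S) (s' ∷ S') s∷S≢s'∷S' u v with S ≟ˢ S' | s | s'
  ... | no S≢S' | s | s' = begin-equality
    Q * collisions (s ∷ S) (s' ∷ S') u v  ≡⟨ cong (Q *_) (collisions-∷ s s' S S' u v) ⟩
    Q * ∑[ x ∈ allFin Q ] collisions S S' (u + contribution s x) (v + contribution s' x)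
      ≡⟨ ∑-*ˡ (allFin Q) Q _ ⟨
    ∑[ x ∈ allFin Q ] (Q * collisions S S' (u + contribution s x) (v + contribution s' x))
      ≡⟨ ∑-cong (allFin Q) (λ x → S≢S'⇒Q*collisions≡Q^M S S' S≢S' _ _) ⟩
    ∑[ x ∈ allFin Q ] (Q ^ M)             ≡⟨ ∑-allFin-const Q (Q ^ M) ⟩
    Q ^ suc M                             ∎
  ... | yes refl | true | true = ⊥-elim (s∷S≢s'∷S' refl)
  ... | yes refl | false | false = ⊥-elim (s∷S≢s'∷S' refl)
  ... | yes refl | true | false =
    cong (Q *_) (trans (collisions-∷ true false S S u v) (∑-collisions-shifted S u (v + 0)))
  ... | yes refl | false | true =
    cong (Q *_) (trans (collisions-∷ false true S S u v)
                (trans (∑-cong (allFin Q) (λ x → collisions-sym S S (u + 0) (v + toℕ x)))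
                       (∑-collisions-shifted S v (u + 0))))

  Q*collisions≤Q^M+δ : ∀ {M} (S S' : Subset M) → Q * collisions S S' 0 0 ≤ Q ^ M + 𝟙 (S ≟ˢ S') * (Q * Q ^ M)
  Q*collisions≤Q^M+δ {M} S S' with S ≟ˢ S'
  ... | yes refl = ≤-trans (*-monoʳ-≤ Q (collisions≤Q^M S S 0 0))
                           (≤-trans (≤-reflexive (sym (+-identityʳ _))) (m≤n+m _ (Q ^ M)))
  ... | no S≢S' = ≤-trans (≤-reflexive (S≢S'⇒Q*collisions≡Q^M S S' S≢S' 0 0)) (m≤m+n _ _)

  ∑-allPairs : ∀ M (f : Vec (Fin Q) M × Fin Q → ℕ) →
    ∑ (allPairs Q M) f ≡ ∑[ a ∈ allVec Q M ] ∑[ c ∈ allFin Q ] f (a , c)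
  ∑-allPairs M f = ∑-cartesianProduct (allVec Q M) (allFin Q) f

  ∑-allPairs-const : ∀ M k → ∑[ ω ∈ allPairs Q M ] k ≡ Q ^ M * Q * k
  ∑-allPairs-const M k = begin-equality
    ∑[ ω ∈ allPairs Q M ] k               ≡⟨ ∑-allPairs M (λ _ → k) ⟩
    ∑[ a ∈ allVec Q M ] ∑[ c ∈ allFin Q ] k ≡⟨ ∑-cong (allVec Q M) (λ _ → ∑-allFin-const Q k) ⟩
    ∑[ a ∈ allVec Q M ] (Q * k)           ≡⟨ ∑-allVec-const M (Q * k) ⟩
    Q ^ M * (Q * k)                       ≡⟨ *-assoc (Q ^ M) Q k ⟨
    Q ^ M * Q * k                         ∎

  module Family (M : ℕ) {ℓ : Level} {F : Subset M → Set ℓ} (F? : Decidable F) where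

    Subs : List (Subset M)
    Subs = allSubsets M

    size : ℕ
    size = ∑[ S ∈ Subs ] 𝟙 (F? S)

    hits : Vec (Fin Q) M × Fin Q → ℕ
    hits (a , c) = ∑[ S ∈ Subs ] (𝟙 (F? S) * 𝟙 (subsetSum a S % Q ≟ toℕ c))

    ∑-hits : ∀ a → ∑[ c ∈ allFin Q ] hits (a , c) ≡ size
    ∑-hits a = begin-equality
      ∑[ c ∈ allFin Q ] hits (a , c)
        ≡⟨ ∑-comm (allFin Q) Subs _ ⟩
      ∑[ S ∈ Subs ] ∑[ c ∈ allFin Q ] (𝟙 (F? S) * 𝟙 (subsetSum a S % Q ≟ toℕ c))
        ≡⟨ ∑-cong Subs (λ S → ∑-*ˡ (allFin Q) (𝟙 (F? S)) _) ⟩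
      ∑[ S ∈ Subs ] (𝟙 (F? S) * ∑[ c ∈ allFin Q ] 𝟙 (subsetSum a S % Q ≟ toℕ c))
        ≡⟨ ∑-cong Subs (λ S → cong (𝟙 (F? S) *_) (∑-residue-δ Q (subsetSum a S))) ⟩
      ∑[ S ∈ Subs ] (𝟙 (F? S) * 1)
        ≡⟨ ∑-cong Subs (λ S → *-identityʳ (𝟙 (F? S))) ⟩
      size ∎

    ∑-hits-allPairs : ∑[ ω ∈ allPairs Q M ] hits ω ≡ Q ^ M * size
    ∑-hits-allPairs = trans (∑-allPairs M hits) (trans (∑-cong (allVec Q M) ∑-hits) (∑-allVec-const M size))

    ∑-hits² : ∀ a → ∑[ c ∈ allFin Q ] (hits (a , c) * hits (a , c)) ≡
      ∑[ S ∈ Subs ] ∑[ S' ∈ Subs ] (𝟙 (F? S) * 𝟙 (F? S') * 𝟙 (subsetSum a S % Q ≟ subsetSum a S' % Q))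
    ∑-hits² a = begin-equality
      ∑[ c ∈ allFin Q ] (hits (a , c) * hits (a , c))
        ≡⟨ ∑-cong (allFin Q) (λ c → ∑-*-∑ Subs Subs (λ S → f S c) (λ S' → f S' c)) ⟩
      ∑[ c ∈ allFin Q ] ∑[ S ∈ Subs ] ∑[ S' ∈ Subs ] (f S c * f S' c)
        ≡⟨ ∑-comm (allFin Q) Subs _ ⟩
      ∑[ S ∈ Subs ] ∑[ c ∈ allFin Q ] ∑[ S' ∈ Subs ] (f S c * f S' c)
        ≡⟨ ∑-cong Subs (λ S → ∑-comm (allFin Q) Subs _) ⟩
      ∑[ S ∈ Subs ] ∑[ S' ∈ Subs ] ∑[ c ∈ allFin Q ] (f S c * f S' c)
        ≡⟨ ∑-cong Subs (λ S → ∑-cong Subs (λ S' → pair S S')) ⟩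
      ∑[ S ∈ Subs ] ∑[ S' ∈ Subs ] (𝟙 (F? S) * 𝟙 (F? S') * 𝟙 (subsetSum a S % Q ≟ subsetSum a S' % Q)) ∎
      where
      r : Subset M → Fin Q → ℕ
      r S c = 𝟙 (subsetSum a S % Q ≟ toℕ c)
      f : Subset M → Fin Q → ℕ
      f S c = 𝟙 (F? S) * r S c
      pair : ∀ S S' → ∑[ c ∈ allFin Q ] (f S c * f S' c) ≡
                      𝟙 (F? S) * 𝟙 (F? S') * 𝟙 (subsetSum a S % Q ≟ subsetSum a S' % Q)
      pair S S' = begin-equality
        ∑[ c ∈ allFin Q ] (f S c * f S' c)
          ≡⟨ ∑-cong (allFin Q) (λ c → *-interchange (𝟙 (F? S)) (r S c) (𝟙 (F? S')) (r S' c)) ⟩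
        ∑[ c ∈ allFin Q ] (𝟙 (F? S) * 𝟙 (F? S') * (r S c * r S' c))
          ≡⟨ ∑-*ˡ (allFin Q) (𝟙 (F? S) * 𝟙 (F? S')) _ ⟩
        𝟙 (F? S) * 𝟙 (F? S') * ∑[ c ∈ allFin Q ] (r S c * r S' c)
          ≡⟨ cong (𝟙 (F? S) * 𝟙 (F? S') *_) (∑-residue-pair Q (subsetSum a S) (subsetSum a S')) ⟩
        𝟙 (F? S) * 𝟙 (F? S') * 𝟙 (subsetSum a S % Q ≟ subsetSum a S' % Q) ∎

    ∑-hits²-allPairs : ∑[ ω ∈ allPairs Q M ] (hits ω * hits ω) ≡
      ∑[ S ∈ Subs ] (𝟙 (F? S) * ∑[ S' ∈ Subs ] (𝟙 (F? S') * collisions S S' 0 0))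
    ∑-hits²-allPairs = begin-equality
      ∑[ ω ∈ allPairs Q M ] (hits ω * hits ω)
        ≡⟨ trans (∑-allPairs M (λ ω → hits ω * hits ω)) (∑-cong (allVec Q M) ∑-hits²) ⟩
      ∑[ a ∈ allVec Q M ] ∑[ S ∈ Subs ] ∑[ S' ∈ Subs ] (𝟙 (F? S) * 𝟙 (F? S') * δ a S S')
        ≡⟨ ∑-comm (allVec Q M) Subs _ ⟩
      ∑[ S ∈ Subs ] ∑[ a ∈ allVec Q M ] ∑[ S' ∈ Subs ] (𝟙 (F? S) * 𝟙 (F? S') * δ a S S')
        ≡⟨ ∑-cong Subs (λ S → ∑-comm (allVec Q M) Subs _) ⟩
      ∑[ S ∈ Subs ] ∑[ S' ∈ Subs ] ∑[ a ∈ allVec Q M ] (𝟙 (F? S) * 𝟙 (F? S') * δ a S S')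
        ≡⟨ ∑-cong Subs (λ S → ∑-cong Subs (λ S' → trans (∑-*ˡ (allVec Q M) (𝟙 (F? S) * 𝟙 (F? S')) (λ a → δ a S S'))
                                                        (*-assoc (𝟙 (F? S)) (𝟙 (F? S')) _))) ⟩
      ∑[ S ∈ Subs ] ∑[ S' ∈ Subs ] (𝟙 (F? S) * (𝟙 (F? S') * collisions S S' 0 0))
        ≡⟨ ∑-cong Subs (λ S → ∑-*ˡ Subs (𝟙 (F? S)) (λ S' → 𝟙 (F? S') * collisions S S' 0 0)) ⟩
      ∑[ S ∈ Subs ] (𝟙 (F? S) * ∑[ S' ∈ Subs ] (𝟙 (F? S') * collisions S S' 0 0)) ∎
      where
      δ : Vec (Fin Q) M → Subset M → Subset M → ℕ
      δ a S S' = 𝟙 (subsetSum a S % Q ≟ subsetSum a S' % Q)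

    Q*∑-collisions≤ : ∀ S → Q * ∑[ S' ∈ Subs ] (𝟙 (F? S') * collisions S S' 0 0) ≤ size * Q ^ M + Q * Q ^ M
    Q*∑-collisions≤ S = begin
      Q * ∑[ S' ∈ Subs ] (𝟙 (F? S') * collisions S S' 0 0)
        ≡⟨ ∑-*ˡ Subs Q _ ⟨
      ∑[ S' ∈ Subs ] (Q * (𝟙 (F? S') * collisions S S' 0 0))
        ≡⟨ ∑-cong Subs (λ S' → x∙yz≈y∙xz Q (𝟙 (F? S')) _) ⟩
      ∑[ S' ∈ Subs ] (𝟙 (F? S') * (Q * collisions S S' 0 0))
        ≤⟨ ∑-mono-≤ Subs (λ S' → *-monoʳ-≤ (𝟙 (F? S')) (Q*collisions≤Q^M+δ S S')) ⟩
      ∑[ S' ∈ Subs ] (𝟙 (F? S') * (Q ^ M + 𝟙 (S ≟ˢ S') * (Q * Q ^ M)))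
        ≤⟨ ∑-mono-≤ Subs (λ S' → m≤1⇒m*[n+o]≤m*n+o (Q ^ M) _ (𝟙≤1 (F? S'))) ⟩
      ∑[ S' ∈ Subs ] (𝟙 (F? S') * Q ^ M + 𝟙 (S ≟ˢ S') * (Q * Q ^ M))
        ≡⟨ ∑-+ Subs _ _ ⟩
      ∑[ S' ∈ Subs ] (𝟙 (F? S') * Q ^ M) + ∑[ S' ∈ Subs ] (𝟙 (S ≟ˢ S') * (Q * Q ^ M))
        ≡⟨ cong₂ _+_ (∑-*ʳ Subs (Q ^ M) (λ S' → 𝟙 (F? S'))) (∑-*ʳ Subs (Q * Q ^ M) (λ S' → 𝟙 (S ≟ˢ S'))) ⟩
      size * Q ^ M + (∑[ S' ∈ Subs ] 𝟙 (S ≟ˢ S')) * (Q * Q ^ M)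
        ≡⟨ cong (λ k → size * Q ^ M + k * (Q * Q ^ M)) (∑-allSubsets-δ S) ⟩
      size * Q ^ M + 1 * (Q * Q ^ M)
        ≡⟨ cong (size * Q ^ M +_) (*-identityˡ (Q * Q ^ M)) ⟩
      size * Q ^ M + Q * Q ^ M ∎

    Q*∑-hits²≤ : Q * ∑[ ω ∈ allPairs Q M ] (hits ω * hits ω) ≤ size * (size * Q ^ M + Q * Q ^ M)
    Q*∑-hits²≤ = begin
      Q * ∑[ ω ∈ allPairs Q M ] (hits ω * hits ω)
        ≡⟨ cong (Q *_) ∑-hits²-allPairs ⟩
      Q * ∑[ S ∈ Subs ] (𝟙 (F? S) * row S)
        ≡⟨ ∑-*ˡ Subs Q _ ⟨
      ∑[ S ∈ Subs ] (Q * (𝟙 (F? S) * row S))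
        ≡⟨ ∑-cong Subs (λ S → x∙yz≈y∙xz Q (𝟙 (F? S)) (row S)) ⟩
      ∑[ S ∈ Subs ] (𝟙 (F? S) * (Q * row S))
        ≤⟨ ∑-mono-≤ Subs (λ S → *-monoʳ-≤ (𝟙 (F? S)) (Q*∑-collisions≤ S)) ⟩
      ∑[ S ∈ Subs ] (𝟙 (F? S) * (size * Q ^ M + Q * Q ^ M))
        ≡⟨ ∑-*ʳ Subs _ (λ S → 𝟙 (F? S)) ⟩
      size * (size * Q ^ M + Q * Q ^ M) ∎
      where
      row : Subset M → ℕ
      row S = ∑[ S' ∈ Subs ] (𝟙 (F? S') * collisions S S' 0 0)

    deviation : Vec (Fin Q) M × Fin Q → ℕ
    deviation ω = ∣ Q * hits ω - size ∣

    ∑-deviation² : ∑[ ω ∈ allPairs Q M ] (deviation ω * deviation ω) ≤ size * (Q ^ M * Q) * Q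
    ∑-deviation² = +-cancelʳ-≤ (2 * Q * size * (Q ^ M * size)) _ _ (begin
      D + 2 * Q * size * (Q ^ M * size)
        ≡⟨ cong (λ k → D + 2 * Q * size * k) ∑-hits-allPairs ⟨
      D + 2 * Q * size * ∑[ ω ∈ allPairs Q M ] hits ω
        ≡⟨ cong (D +_) (∑-*ˡ (allPairs Q M) (2 * Q * size) hits) ⟨
      D + ∑[ ω ∈ allPairs Q M ] (2 * Q * size * hits ω)
        ≡⟨ ∑-+ (allPairs Q M) (λ ω → deviation ω * deviation ω) (λ ω → 2 * Q * size * hits ω) ⟨
      ∑[ ω ∈ allPairs Q M ] (deviation ω * deviation ω + 2 * Q * size * hits ω)
        ≡⟨ ∑-cong (allPairs Q M) (λ ω → expand size (hits ω)) ⟩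
      ∑[ ω ∈ allPairs Q M ] (Q * Q * (hits ω * hits ω) + size * size)
        ≡⟨ ∑-+ (allPairs Q M) (λ ω → Q * Q * (hits ω * hits ω)) (λ _ → size * size) ⟩
      ∑[ ω ∈ allPairs Q M ] (Q * Q * (hits ω * hits ω)) + ∑[ ω ∈ allPairs Q M ] (size * size)
        ≡⟨ cong₂ _+_ (trans (∑-*ˡ (allPairs Q M) (Q * Q) (λ ω → hits ω * hits ω)) (*-assoc Q Q _))
                     (∑-allPairs-const M (size * size)) ⟩
      Q * (Q * ∑[ ω ∈ allPairs Q M ] (hits ω * hits ω)) + Q ^ M * Q * (size * size)
        ≤⟨ +-monoˡ-≤ _ (*-monoʳ-≤ Q Q*∑-hits²≤) ⟩
      Q * (size * (size * Q ^ M + Q * Q ^ M)) + Q ^ M * Q * (size * size)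
        ≡⟨ collect Q size (Q ^ M) ⟩
      size * (Q ^ M * Q) * Q + 2 * Q * size * (Q ^ M * size) ∎)
      where
      D : ℕ
      D = ∑[ ω ∈ allPairs Q M ] (deviation ω * deviation ω)
      expand : ∀ p x → ∣ Q * x - p ∣ * ∣ Q * x - p ∣ + 2 * Q * p * x ≡ Q * Q * (x * x) + p * p
      expand p x = begin-equality
        ∣ Q * x - p ∣ * ∣ Q * x - p ∣ + 2 * Q * p * x   ≡⟨ cong (∣ Q * x - p ∣ * ∣ Q * x - p ∣ +_) (regroup Q p x) ⟩
        ∣ Q * x - p ∣ * ∣ Q * x - p ∣ + 2 * (Q * x) * p ≡⟨ ∣m-n∣²+2mn≡m²+n² (Q * x) p ⟩
        Q * x * (Q * x) + p * p                         ≡⟨ cong (_+ p * p) (*-interchange Q x Q x) ⟩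
        Q * Q * (x * x) + p * p                         ∎
        where
        regroup : ∀ q p x → 2 * q * p * x ≡ 2 * (q * x) * p
        regroup = solve-∀
      collect : ∀ q p w → q * (p * (p * w + q * w)) + w * q * (p * p) ≡ p * (w * q) * q + 2 * q * p * (w * p)
      collect = solve-∀

    deviation-tail : 0 < size → ∀ n d →
      (∑[ ω ∈ allPairs Q M ] 𝟙 (n * size ≤? d * deviation ω)) * (n * n * size) ≤ d * d * (Q ^ M * Q * Q)
    deviation-tail size>0 n d = *-cancelʳ-≤ _ _ size {{>-nonZero size>0}} (begin
      T * (n * n * size) * size
        ≡⟨ square-form T n size ⟩
      T * (n * size * (n * size))
        ≤⟨ chebyshev (allPairs Q M) (λ ω → d * deviation ω) (n * size) ⟩
      ∑[ ω ∈ allPairs Q M ] (d * deviation ω * (d * deviation ω))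
        ≡⟨ ∑-cong (allPairs Q M) (λ ω → *-interchange d (deviation ω) d (deviation ω)) ⟩
      ∑[ ω ∈ allPairs Q M ] (d * d * (deviation ω * deviation ω))
        ≡⟨ ∑-*ˡ (allPairs Q M) (d * d) (λ ω → deviation ω * deviation ω) ⟩
      d * d * ∑[ ω ∈ allPairs Q M ] (deviation ω * deviation ω)
        ≤⟨ *-monoʳ-≤ (d * d) ∑-deviation² ⟩
      d * d * (size * (Q ^ M * Q) * Q)
        ≡⟨ reorder d size (Q ^ M) Q ⟩
      d * d * (Q ^ M * Q * Q) * size ∎)
      where
      T : ℕ
      T = ∑[ ω ∈ allPairs Q M ] 𝟙 (n * size ≤? d * deviation ω)
      square-form : ∀ t n p → t * (n * n * p) * p ≡ t * (n * p * (n * p))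
      square-form = solve-∀
      reorder : ∀ d p w q → d * d * (p * (w * q) * q) ≡ d * d * (w * q * q) * p
      reorder = solve-∀

module Fractions where

  open import Data.Nat.Base as ℕ using (ℕ; zero; suc; NonZero)
  import Data.Nat.Properties as ℕ
  open import Data.Integer.Base as ℤ using (+_; +≤+; +<+; +[1+_]; -[1+_])
  import Data.Integer.Properties as ℤ
  open import Data.Rational.Base using (ℚ; mkℚ; _/_; 1/_; _+_; _-_; -_; _*_; _≤_; _<_; 0ℚ; 1ℚ; toℚᵘ; positive)
  open import Data.Rational.Properties
    using (toℚᵘ-fromℚᵘ; toℚᵘ-injective; toℚᵘ-homo-*; toℚᵘ-homo-+; toℚᵘ-mono-≤; toℚᵘ-mono-<; toℚᵘ-cancel-≤;
           toℚᵘ-cancel-<; +-assoc; +-inverseʳ; +-identityʳ; *-assoc; *-inverseˡ; *-identityʳ)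
  open import Data.Rational.Unnormalised.Base as ℚᵘ using (mkℚᵘ; *≡*; *≤*; *<*)
  import Data.Rational.Unnormalised.Properties as ℚᵘ
  open import Data.Product using (∃-syntax; _×_; _,_)
  open import Relation.Binary.PropositionalEquality
  open import Defs using (_÷'_)

  -- Stated through the unnormalised representation, so p ≐ a / b is checked by
  -- cross-multiplication and the gcd normalisation inside ℚ's _/_ is never unfolded on open terms.
  infix 4 _≐_/_

  _≐_/_ : ℚ → (a b : ℕ) .{{_ : NonZero b}} → Set
  p ≐ a / b = toℚᵘ p ℚᵘ.≃ (+ a ℚᵘ./ b)

  ≐-/ : ∀ a b .{{_ : NonZero b}} → (+ a / b) ≐ a / b
  ≐-/ a (suc b) = toℚᵘ-fromℚᵘ (mkℚᵘ (+ a) b)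

  ≐-0 : 0ℚ ≐ 0 / 1
  ≐-0 = ℚᵘ.≃-refl

  ≐-1 : 1ℚ ≐ 1 / 1
  ≐-1 = ℚᵘ.≃-refl

  ≐-* : ∀ {p q a b c d} .{{_ : NonZero b}} .{{_ : NonZero d}} →
    p ≐ a / b → q ≐ c / d → ((p * q) ≐ a ℕ.* c / (b ℕ.* d)) {{ℕ.m*n≢0 b d}}
  ≐-* {p} {q} {a} {b} {c} {d} p≐a/b q≐c/d =
    ℚᵘ.≃-trans (toℚᵘ-homo-* p q) (ℚᵘ.≃-trans (ℚᵘ.*-cong p≐a/b q≐c/d) (ℚᵘ.≃-reflexive (/ᵘ-*-/ᵘ a b c d)))
    where
    /ᵘ-*-/ᵘ : ∀ a b c d .{{_ : NonZero b}} .{{_ : NonZero d}} →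
      (+ a ℚᵘ./ b) ℚᵘ.* (+ c ℚᵘ./ d) ≡ (+ (a ℕ.* c) ℚᵘ./ (b ℕ.* d)) {{ℕ.m*n≢0 b d}}
    /ᵘ-*-/ᵘ a (suc b) c (suc d) = cong (λ i → mkℚᵘ i (d ℕ.+ b ℕ.* suc d)) (sym (ℤ.pos-* a c))

  ≐-+ : ∀ {p q a b c d} .{{_ : NonZero b}} .{{_ : NonZero d}} →
    p ≐ a / b → q ≐ c / d → ((p + q) ≐ a ℕ.* d ℕ.+ c ℕ.* b / (b ℕ.* d)) {{ℕ.m*n≢0 b d}}
  ≐-+ {p} {q} {a} {b} {c} {d} p≐a/b q≐c/d =
    ℚᵘ.≃-trans (toℚᵘ-homo-+ p q) (ℚᵘ.≃-trans (ℚᵘ.+-cong p≐a/b q≐c/d) (ℚᵘ.≃-reflexive (/ᵘ-+-/ᵘ a b c d)))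
    where
    /ᵘ-+-/ᵘ : ∀ a b c d .{{_ : NonZero b}} .{{_ : NonZero d}} →
      (+ a ℚᵘ./ b) ℚᵘ.+ (+ c ℚᵘ./ d) ≡ (+ (a ℕ.* d ℕ.+ c ℕ.* b) ℚᵘ./ (b ℕ.* d)) {{ℕ.m*n≢0 b d}}
    /ᵘ-+-/ᵘ a (suc b) c (suc d) = cong (λ i → mkℚᵘ i (d ℕ.+ b ℕ.* suc d))
      (sym (trans (ℤ.pos-+ (a ℕ.* suc d) (c ℕ.* suc b)) (cong₂ ℤ._+_ (ℤ.pos-* a (suc d)) (ℤ.pos-* c (suc b)))))

  ≐-≃ : ∀ {p a b c d} .{{_ : NonZero b}} .{{_ : NonZero d}} → p ≐ a / b → a ℕ.* d ≡ c ℕ.* b → p ≐ c / d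
  ≐-≃ {a = a} {b@(suc _)} {c} {d@(suc _)} p≐a/b ad≡cb =
    ℚᵘ.≃-trans p≐a/b (*≡* (trans (sym (ℤ.pos-* a d)) (trans (cong +_ ad≡cb) (ℤ.pos-* c b))))

  ≐-≤ : ∀ {p q a b c d} .{{_ : NonZero b}} .{{_ : NonZero d}} → p ≐ a / b → q ≐ c / d →
    p ≤ q → a ℕ.* d ℕ.≤ c ℕ.* b
  ≐-≤ {a = a} {b@(suc _)} {c} {d@(suc _)} p≐a/b q≐c/d p≤q
    with ℚᵘ.≤-respʳ-≃ q≐c/d (ℚᵘ.≤-respˡ-≃ p≐a/b (toℚᵘ-mono-≤ p≤q))
  ... | *≤* ad≤cb = ℤ.drop‿+≤+ (subst₂ ℤ._≤_ (sym (ℤ.pos-* a d)) (sym (ℤ.pos-* c b)) ad≤cb)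

  ≤-≐ : ∀ {p q a b c d} .{{_ : NonZero b}} .{{_ : NonZero d}} → p ≐ a / b → q ≐ c / d →
    a ℕ.* d ℕ.≤ c ℕ.* b → p ≤ q
  ≤-≐ {a = a} {b@(suc _)} {c} {d@(suc _)} p≐a/b q≐c/d ad≤cb =
    toℚᵘ-cancel-≤ (ℚᵘ.≤-respˡ-≃ (ℚᵘ.≃-sym p≐a/b) (ℚᵘ.≤-respʳ-≃ (ℚᵘ.≃-sym q≐c/d)
      (*≤* (subst₂ ℤ._≤_ (ℤ.pos-* a d) (ℤ.pos-* c b) (+≤+ ad≤cb)))))

  <-≐ : ∀ {p q a b c d} .{{_ : NonZero b}} .{{_ : NonZero d}} → p ≐ a / b → q ≐ c / d →
    a ℕ.* d ℕ.< c ℕ.* b → p < q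
  <-≐ {a = a} {b@(suc _)} {c} {d@(suc _)} p≐a/b q≐c/d ad<cb =
    toℚᵘ-cancel-< (ℚᵘ.<-respˡ-≃ (ℚᵘ.≃-sym p≐a/b) (ℚᵘ.<-respʳ-≃ (ℚᵘ.≃-sym q≐c/d)
      (*<* (subst₂ ℤ._<_ (ℤ.pos-* a d) (ℤ.pos-* c b) (+<+ ad<cb)))))

  ≐-unique : ∀ {p q a b} .{{_ : NonZero b}} → p ≐ a / b → q ≐ a / b → p ≡ q
  ≐-unique p≐a/b q≐a/b = toℚᵘ-injective (ℚᵘ.≃-trans p≐a/b (ℚᵘ.≃-sym q≐a/b))

  1-≐ : ∀ {ε n s d} .{{_ : NonZero s}} .{{_ : NonZero d}} → ε ≐ n / d → n ℕ.+ s ≡ d → (1ℚ - ε) ≐ s / d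
  1-≐ {ε} {n} {s} {d} ε≐n/d n+s≡d = subst (λ p → p ≐ s / d) (sym 1-ε≡x) (≐-/ s d)
    where
    instance
      d*d≢0 : NonZero (d ℕ.* d)
      d*d≢0 = ℕ.m*n≢0 d d
    x : ℚ
    x = + s / d
    x+ε≡1 : x + ε ≡ 1ℚ
    x+ε≡1 = ≐-unique (≐-≃ (≐-+ (≐-/ s d) ε≐n/d) (begin
      (s ℕ.* d ℕ.+ n ℕ.* d) ℕ.* 1 ≡⟨ ℕ.*-identityʳ _ ⟩
      s ℕ.* d ℕ.+ n ℕ.* d         ≡⟨ ℕ.*-distribʳ-+ d s n ⟨
      (s ℕ.+ n) ℕ.* d             ≡⟨ cong (ℕ._* d) (trans (ℕ.+-comm s n) n+s≡d) ⟩
      d ℕ.* d                     ≡⟨ ℕ.*-identityˡ _ ⟨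
      1 ℕ.* (d ℕ.* d)             ∎)) ≐-1
      where open ≡-Reasoning
    1-ε≡x : 1ℚ - ε ≡ x
    1-ε≡x = begin
      1ℚ - ε          ≡⟨ cong (_- ε) x+ε≡1 ⟨
      (x + ε) - ε     ≡⟨ +-assoc x ε (- ε) ⟩
      x + (ε - ε)     ≡⟨ cong (λ q → x + q) (+-inverseʳ ε) ⟩
      x + 0ℚ          ≡⟨ +-identityʳ x ⟩
      x               ∎
      where open ≡-Reasoning

  proper-fraction : ∀ ε → 0ℚ < ε → ε < 1ℚ → ∃[ n ] ∃[ s ] ∃[ d ] (n ℕ.+ suc s ≡ suc d × ε ≐ n / suc d)
  proper-fraction (mkℚ (+ n) d _) 0<ε ε<1 with toℚᵘ-mono-< ε<1
  ... | *<* n*1<1*d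
    with ℕ.m≤n⇒∃[o]m+o≡n (ℤ.drop‿+<+ (subst₂ ℤ._<_ (ℤ.*-identityʳ (+ n)) (ℤ.*-identityˡ (+ suc d)) n*1<1*d))
  ...   | s , n+1+s≡d = n , s , d , trans (ℕ.+-suc n s) n+1+s≡d , ℚᵘ.≃-refl
  proper-fraction (mkℚ -[1+ _ ] _ _) 0<ε _ with positive 0<ε
  ... | ()

  ÷'-*-cancel : ∀ p q → 0ℚ < q → (p ÷' q) * q ≡ p
  ÷'-*-cancel p (mkℚ (+ zero) _ _) 0<q with positive 0<q
  ... | ()
  ÷'-*-cancel p q@(mkℚ +[1+ _ ] _ _) _ =
    trans (*-assoc p (1/ q) q) (trans (cong (p *_) (*-inverseˡ q)) (*-identityʳ p))
  ÷'-*-cancel p (mkℚ -[1+ _ ] _ _) 0<q with positive 0<q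
  ... | ()

module Threshold where

  open import Data.Nat.Base as ℕ using (NonZero)
  import Data.Nat.Properties as ℕ
  open import Data.Nat.Tactic.RingSolver using (solve-∀)
  open import Data.Integer.Base using (+_)
  open import Data.Rational.Base using (ℚ; _/_; _+_; _-_; _*_; _≤_; _<_; 0ℚ; 1ℚ; nonNegative)
  open import Data.Rational.Properties using (*-assoc; *-comm; *-monoʳ-≤-nonNeg; <⇒≤)
  open import Relation.Binary.PropositionalEquality
  open import Defs
  open Fractions

  threshold≤⇒ : ∀ {ε h} n s d t M N₁ N .{{_ : NonZero s}} .{{_ : NonZero d}} .{{_ : NonZero M}} .{{_ : NonZero N}} →
    ε ≐ n / d → n ℕ.+ s ≡ d → h ≐ N₁ / N → threshold ε t M ≤ h → (d ℕ.+ n) ℕ.* t ℕ.* N ℕ.≤ N₁ ℕ.* s ℕ.* M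
  threshold≤⇒ {ε} {h} n s d t M N₁ N ε≐n/d n+s≡d h≐N₁/N bad =
    ℕ.*-cancelʳ-≤ _ _ d (subst₂ ℕ._≤_ (regroup (d ℕ.+ n) t N d) (regroup′ N₁ s d M) cross)
    where
    instance
      d*M≢0 : NonZero (d ℕ.* M)
      d*M≢0 = ℕ.m*n≢0 d M
      N*d≢0 : NonZero (N ℕ.* d)
      N*d≢0 = ℕ.m*n≢0 N d
      1*d≢0 : NonZero (1 ℕ.* d)
      1*d≢0 = ℕ.m*n≢0 1 d
    1+ε≐ : (1ℚ + ε) ≐ d ℕ.+ n / d
    1+ε≐ = ≐-≃ (≐-+ ≐-1 ε≐n/d) (trans (cong₂ (λ x y → (x ℕ.+ y) ℕ.* d) (ℕ.*-identityˡ d) (ℕ.*-identityʳ n))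
                                      (cong ((d ℕ.+ n) ℕ.*_) (sym (ℕ.*-identityˡ d))))
    1-ε≐ : (1ℚ - ε) ≐ s / d
    1-ε≐ = 1-≐ ε≐n/d n+s≡d
    0<1-ε : 0ℚ < 1ℚ - ε
    0<1-ε = <-≐ ≐-0 1-ε≐ (subst (0 ℕ.<_) (sym (ℕ.*-identityʳ s)) (ℕ.>-nonZero⁻¹ s))
    r T : ℚ
    r = (1ℚ + ε) ÷' (1ℚ - ε)
    T = + t / M
    cancel : threshold ε t M * (1ℚ - ε) ≡ (1ℚ + ε) * T
    cancel = begin
      r * T * (1ℚ - ε)     ≡⟨ *-assoc r T (1ℚ - ε) ⟩
      r * (T * (1ℚ - ε))   ≡⟨ cong (r *_) (*-comm T (1ℚ - ε)) ⟩
      r * ((1ℚ - ε) * T)   ≡⟨ *-assoc r (1ℚ - ε) T ⟨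
      r * (1ℚ - ε) * T     ≡⟨ cong (_* T) (÷'-*-cancel (1ℚ + ε) (1ℚ - ε) 0<1-ε) ⟩
      (1ℚ + ε) * T         ∎
      where open ≡-Reasoning
    scaled : (1ℚ + ε) * T ≤ h * (1ℚ - ε)
    scaled = subst (_≤ h * (1ℚ - ε)) cancel (*-monoʳ-≤-nonNeg (1ℚ - ε) {{nonNegative (<⇒≤ 0<1-ε)}} bad)
    cross : (d ℕ.+ n) ℕ.* t ℕ.* (N ℕ.* d) ℕ.≤ N₁ ℕ.* s ℕ.* (d ℕ.* M)
    cross = ≐-≤ (≐-* 1+ε≐ (≐-/ t M)) (≐-* h≐N₁/N 1-ε≐) scaled
    regroup : ∀ a t N d → a ℕ.* t ℕ.* (N ℕ.* d) ≡ a ℕ.* t ℕ.* N ℕ.* d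
    regroup = solve-∀
    regroup′ : ∀ N₁ s d M → N₁ ℕ.* s ℕ.* (d ℕ.* M) ≡ N₁ ℕ.* s ℕ.* M ℕ.* d
    regroup′ = solve-∀


module BadPairs (Q : ℕ) .{{_ : NonZero Q}} (m t′ : ℕ) (t′≤m : t′ ℕ.≤ m)
            (n s′ d′ : ℕ) (n+s≡d : n ℕ.+ suc s′ ≡ suc d′) (ε : ℚ) (ε≐n/d : ε Fractions.≐ n / suc d′) where

  open import Data.Nat using (ℕ; zero; suc; _+_; _*_; _^_; _%_; _≤_; _<_; _≟_; _≤?_; NonZero; z≤n)
  open import Data.Nat.Properties
  open import Data.Nat.Combinatorics using (_C_)
  open import Relation.Nullary using (Dec)
  open import Data.Integer using (+_)
  open import Data.Rational as ℚ using (ℚ; _/_)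
  open import Data.List using (List; length; filter)
  open import Data.Vec using (Vec)
  open import Data.Fin using (Fin; toℕ)
  open import Data.Fin.Subset using (Subset; ∣_∣)
  open import Data.Product using (_,_)
  open import Data.Sum using (_⊎_)
  open import Relation.Nullary.Decidable using (_×-dec_)
  open import Relation.Binary.PropositionalEquality
  open import Algebra.Properties.CommutativeSemigroup *-commutativeSemigroup using (xy∙z≈xz∙y)
  open import Defs
  open Sums
  open Arithmetic
  open Subsets
  open SubsetSums Q
  open Fractions
  open Threshold

  M t s d Ω : ℕ
  M = suc m
  t = suc t′
  s = suc s′
  d = suc d′
  Ω = Q ^ M * Q

  module 𝒮 = Family M (λ S → ∣ S ∣ ≟ t)
  module 𝒮₁ = Family M (λ S → (∣ S ∣ ≟ t) ×-dec containsFirst? S)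

  size≡MCt : 𝒮.size ≡ M C t
  size≡MCt = #subsets-of-size M t

  size₁≡mCt′ : 𝒮₁.size ≡ m C t′
  size₁≡mCt′ = #subsets-of-size-containing-first m t′

  size₁>0 : 0 < 𝒮₁.size
  size₁>0 = subst (0 <_) (sym size₁≡mCt′) (k≤n⇒nCk>0 t′≤m)

  size₁≤size : 𝒮₁.size ≤ 𝒮.size
  size₁≤size = subst₂ _≤_ (sym size₁≡mCt′) (sym size≡MCt) (nCk≤[n+1]C[k+1] m t′)

  t*size≡M*size₁ : t * 𝒮.size ≡ M * 𝒮₁.size
  t*size≡M*size₁ = trans (cong (t *_) size≡MCt) (trans ([k+1]*[n+1]C[k+1]≡[n+1]*nCk m t′) (cong (M *_) (sym size₁≡mCt′)))

  good : Vec (Fin Q) M → Fin Q → List (Subset M)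
  good a c = filter (good? Q M t a c) (allSubsets M)

  #good≡hits : ∀ a c → length (good a c) ≡ 𝒮.hits (a , c)
  #good≡hits a c = trans (length-filter≡∑𝟙 (good? Q M t a c) (allSubsets M))
                         (∑-cong (allSubsets M) (λ S → 𝟙-× (∣ S ∣ ≟ t) (subsetSum a S % Q ≟ toℕ c)))

  #good-first≡hits₁ : ∀ a c → length (filter containsFirst? (good a c)) ≡ 𝒮₁.hits (a , c)
  #good-first≡hits₁ a c = begin
    length (filter containsFirst? (good a c))
      ≡⟨ length-filter≡∑𝟙 containsFirst? (good a c) ⟩
    ∑[ S ∈ good a c ] 𝟙 (containsFirst? S)
      ≡⟨ ∑-filter (good? Q M t a c) (allSubsets M) (λ S → 𝟙 (containsFirst? S)) ⟩
    ∑[ S ∈ allSubsets M ] (𝟙 (good? Q M t a c S) * 𝟙 (containsFirst? S))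
      ≡⟨ ∑-cong (allSubsets M) regroup ⟩
    𝒮₁.hits (a , c) ∎
    where
    open ≡-Reasoning
    regroup : ∀ S → 𝟙 (good? Q M t a c S) * 𝟙 (containsFirst? S) ≡
                    𝟙 ((∣ S ∣ ≟ t) ×-dec containsFirst? S) * 𝟙 (subsetSum a S % Q ≟ toℕ c)
    regroup S = trans (cong (_* 𝟙 (containsFirst? S)) (𝟙-× (∣ S ∣ ≟ t) (subsetSum a S % Q ≟ toℕ c)))
                (trans (xy∙z≈xz∙y (𝟙 (∣ S ∣ ≟ t)) (𝟙 (subsetSum a S % Q ≟ toℕ c)) (𝟙 (containsFirst? S)))
                       (cong (_* 𝟙 (subsetSum a S % Q ≟ toℕ c)) (sym (𝟙-× (∣ S ∣ ≟ t) (containsFirst? S)))))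

  hitProb≐ : ∀ a c k → length (good a c) ≡ suc k → hitProb Q m t a c ≐ length (filter containsFirst? (good a c)) / suc k
  hitProb≐ a c k #good≡1+k with length (good a c)
  hitProb≐ a c k refl | .(suc k) = ≐-/ (length (filter containsFirst? (good a c))) (suc k)

  bad⇒ratio : ∀ a c → Bad Q m t ε (a , c) → (d + n) * t * 𝒮.hits (a , c) ≤ 𝒮₁.hits (a , c) * s * M
  bad⇒ratio a c bad = subst₂ (λ N N₁ → (d + n) * t * N ≤ N₁ * s * M) (#good≡hits a c) (#good-first≡hits₁ a c)
                             (ratio (length (good a c)) refl)
    where
    ratio : ∀ N → length (good a c) ≡ N → (d + n) * t * N ≤ length (filter containsFirst? (good a c)) * s * M
    -- No admissible subset: p_{a,c,t} = 1 by convention, and the bound holds trivially.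
    ratio zero _ = subst (_≤ length (filter containsFirst? (good a c)) * s * M) (sym (*-zeroʳ ((d + n) * t))) z≤n
    ratio (suc k) #good≡1+k = threshold≤⇒ n s d t (suc m) (length (filter containsFirst? (good a c))) (suc k)
                                          ε≐n/d n+s≡d (hitProb≐ a c k #good≡1+k) bad

  bad⇒large-deviation : ∀ ω → Bad Q m t ε ω →
    n * 𝒮₁.size ≤ d * 𝒮₁.deviation ω ⊎ n * 𝒮.size ≤ d * 𝒮.deviation ω
  bad⇒large-deviation (a , c) bad =
    deviation-dichotomy {n} {s} {d} {t} {M} {𝒮₁.size} {𝒮.size} Q (𝒮.hits (a , c)) (𝒮₁.hits (a , c))
                        n+s≡d t*size≡M*size₁ (bad⇒ratio a c bad)

  #bad : ℕ
  #bad = length (filter (bad? Q m t ε) (allPairs Q M))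

  #bad≤Ω : #bad ≤ Ω
  #bad≤Ω = begin
    #bad                                     ≡⟨ length-filter≡∑𝟙 (bad? Q m t ε) (allPairs Q M) ⟩
    ∑[ ω ∈ allPairs Q M ] 𝟙 (bad? Q m t ε ω) ≤⟨ ∑-mono-≤ (allPairs Q M) (λ ω → 𝟙≤1 (bad? Q m t ε ω)) ⟩
    ∑[ ω ∈ allPairs Q M ] 1                  ≡⟨ ∑-allPairs-const M 1 ⟩
    Ω * 1                                    ≡⟨ *-identityʳ Ω ⟩
    Ω                                        ∎
    where open ≤-Reasoning

  #bad*n²K≤ : #bad * (n * n * 𝒮₁.size) ≤ 2 * (d * d * (Ω * Q))
  #bad*n²K≤ = begin
    #bad * (n * n * K)
      ≡⟨ cong (_* (n * n * K)) (length-filter≡∑𝟙 (bad? Q m t ε) (allPairs Q M)) ⟩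
    (∑[ ω ∈ allPairs Q M ] 𝟙 (bad? Q m t ε ω)) * (n * n * K)
      ≤⟨ *-monoˡ-≤ (n * n * K) union-bound ⟩
    (#large₁ + #large₀) * (n * n * K)
      ≡⟨ *-distribʳ-+ (n * n * K) #large₁ #large₀ ⟩
    #large₁ * (n * n * K) + #large₀ * (n * n * K)
      ≤⟨ +-mono-≤ (𝒮₁.deviation-tail size₁>0 n d)
                  (≤-trans (*-monoʳ-≤ #large₀ (*-monoʳ-≤ (n * n) size₁≤size)) (𝒮.deviation-tail size>0 n d)) ⟩
    d * d * (Ω * Q) + d * d * (Ω * Q)
      ≡⟨ cong (λ x → d * d * (Ω * Q) + x) (+-identityʳ (d * d * (Ω * Q))) ⟨
    2 * (d * d * (Ω * Q)) ∎
    where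
    open ≤-Reasoning
    K : ℕ
    K = 𝒮₁.size
    size>0 : 0 < 𝒮.size
    size>0 = <-≤-trans size₁>0 size₁≤size
    large₁? : ∀ ω → Dec (n * 𝒮₁.size ≤ d * 𝒮₁.deviation ω)
    large₁? ω = n * 𝒮₁.size ≤? d * 𝒮₁.deviation ω
    large₀? : ∀ ω → Dec (n * 𝒮.size ≤ d * 𝒮.deviation ω)
    large₀? ω = n * 𝒮.size ≤? d * 𝒮.deviation ω
    #large₁ #large₀ : ℕ
    #large₁ = ∑[ ω ∈ allPairs Q M ] 𝟙 (large₁? ω)
    #large₀ = ∑[ ω ∈ allPairs Q M ] 𝟙 (large₀? ω)
    union-bound : ∑[ ω ∈ allPairs Q M ] 𝟙 (bad? Q m t ε ω) ≤ #large₁ + #large₀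
    union-bound =
      ≤-trans (∑-mono-≤ (allPairs Q M) (λ ω → 𝟙-⊎ (bad⇒large-deviation ω) (bad? Q m t ε ω) (large₁? ω) (large₀? ω)))
              (≤-reflexive (∑-+ (allPairs Q M) (λ ω → 𝟙 (large₁? ω)) (λ ω → 𝟙 (large₀? ω))))

  bound : let P = ε ℚ.* badProb Q m t ε in
    P ℚ.* P ℚ.* P ℚ.* P ℚ.* ((+ (m C t′)) / 1) ℚ.≤ (+ (256 * Q)) / 1
  bound = ≤-≐ P⁴K≐ (≐-/ (256 * Q) 1) (fourth-power-bound n≤d #bad≤Ω #bad*n²*mCt′≤)
    where
    instance
      Ω≢0 : NonZero Ω
      Ω≢0 = m*n≢0 (Q ^ M) Q {{m^n≢0 Q M}}
      dΩ≢0 : NonZero (d * Ω)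
      dΩ≢0 = m*n≢0 d Ω
      [dΩ]²≢0 : NonZero (d * Ω * (d * Ω))
      [dΩ]²≢0 = m*n≢0 (d * Ω) (d * Ω)
      [dΩ]³≢0 : NonZero (d * Ω * (d * Ω) * (d * Ω))
      [dΩ]³≢0 = m*n≢0 (d * Ω * (d * Ω)) (d * Ω)
      [dΩ]⁴≢0 : NonZero (d * Ω * (d * Ω) * (d * Ω) * (d * Ω))
      [dΩ]⁴≢0 = m*n≢0 (d * Ω * (d * Ω) * (d * Ω)) (d * Ω)
      [dΩ]⁴*1≢0 : NonZero (d * Ω * (d * Ω) * (d * Ω) * (d * Ω) * 1)
      [dΩ]⁴*1≢0 = m*n≢0 (d * Ω * (d * Ω) * (d * Ω) * (d * Ω)) 1
    P≐ : (ε ℚ.* badProb Q m t ε) ≐ n * #bad / (d * Ω)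
    P≐ = ≐-* ε≐n/d (≐-/ #bad Ω)
    P⁴K≐ : let P = ε ℚ.* badProb Q m t ε in
      (P ℚ.* P ℚ.* P ℚ.* P ℚ.* ((+ (m C t′)) / 1)) ≐ n * #bad * (n * #bad) * (n * #bad) * (n * #bad) * (m C t′)
                                                  / (d * Ω * (d * Ω) * (d * Ω) * (d * Ω) * 1)
    P⁴K≐ = ≐-* (≐-* (≐-* (≐-* P≐ P≐) P≐) P≐) (≐-/ (m C t′) 1)
    n≤d : n ≤ d
    n≤d = ≤-trans (m≤m+n n (suc s′)) (≤-reflexive n+s≡d)
    #bad*n²*mCt′≤ : #bad * (n * n * (m C t′)) ≤ 2 * (d * d * (Ω * Q))
    #bad*n²*mCt′≤ = subst (λ K → #bad * (n * n * K) ≤ 2 * (d * d * (Ω * Q))) size₁≡mCt′ #bad*n²K≤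

open import Defs
open import Data.Nat as ℕ using (ℕ; suc; NonZero; _∸_)
open import Data.Nat.Combinatorics using (_C_)
open import Data.Integer using (+_)
open import Data.Rational using (ℚ; 0ℚ; 1ℚ; _<_; _≤_; _*_; _/_)
open import Data.Product using (_,_)
open Fractions using (proper-fraction)

lemma2p6 : (Q m t : ℕ) .{{_ : NonZero Q}} → 1 ℕ.≤ t → t ℕ.≤ suc m →
    (ε : ℚ) → 0ℚ < ε → ε < 1ℚ →
    let P = ε * badProb Q m t ε in
    P * P * P * P * ((+ (m C (t ∸ 1))) / 1) ≤ (+ (256 ℕ.* Q)) / 1
lemma2p6 Q m (suc t′) _ (ℕ.s≤s t′≤m) ε 0<ε ε<1 =
  let n , s′ , d′ , n+s≡d , ε≐n/d = proper-fraction ε 0<ε ε<1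
  in BadPairs.bound Q m t′ t′≤m n s′ d′ n+s≡d ε ε≐n/d
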